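{- Let $w \in V^*$ with $|w| = n$, let $a \in V$, and suppose $w \notin a^*$ and $w a^n \in Q_{\overline{I}}$. Then there exist words $u_1, u_2 \in V^*$ and a letter $b \in V$ with $b \ne a$ such that, setting $u = u_1 b u_2$, we have $w a^n = u^2 u_1 u_2$.
   Context: $V$ is a finite alphabet with at least two distinct letters; $V^*$ is the set of all finite words over $V$ (including the empty word), $|w|$ is the length of $w$, and $a^*$ is the set of words consisting only of the letter $a$ (including the empty word). A nonempty word $w$ is primitive if it is not of the form $v^n$ for a word $v$ and an integer $n \ge 2$; $Q$ is the set of primitive words. For a word $w$ of length $n$, $w[1..i]$ denotes its prefix of length $i$ and $w[i+1..n]$ its suffix of length $n-i$. A primitive word $w$ of length $n$ is ins-robust if for every $i \in \{0,\ldots,n\}$ and every $c \in V$ the word $w[1..i]\,c\,w[i+1..n]$ is primitive; $Q_I$ is the set of ins-robust primitive words and $Q_{\overline{I}} = Q \setminus Q_I$. -}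

module Defs where

open import Data.Nat using (ℕ; zero; suc; _≥_)
open import Data.List using (List; []; _∷_; _++_; length; take; drop; replicate)
open import Data.List.Membership.Propositional using (_∈_)
open import Data.List.Relation.Unary.All using (All)
open import Data.Product using (Σ; ∃; ∃-syntax; _×_; _,_)
open import Relation.Binary.PropositionalEquality using (_≡_; _≢_)
open import Relation.Binary.Definitions using (DecidableEquality)
open import Relation.Nullary using (¬_)

record Alphabet : Set₁ where
  field
    Letter   : Set
    _≟_      : DecidableEquality Letter
    letters  : List Letter
    complete : (c : Letter) → c ∈ letters
    x₀ x₁    : Letter
    x₀≢x₁    : x₀ ≢ x₁

module Words {V : Set} where

  Word : Set
  Word = List V

  _^_ : Word → ℕ → Word
  v ^ zero  = []
  v ^ suc n = v ++ (v ^ n)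

  InStar : V → Word → Set
  InStar a w = All (_≡ a) w

  Primitive : Word → Set
  Primitive w = (w ≢ []) × ¬ (Σ Word λ v → Σ ℕ λ n → (n ≥ 2) × (w ≡ v ^ n))

  insertAt : ℕ → V → Word → Word
  insertAt i c w = take i w ++ (c ∷ drop i w)

  InsRobust : Word → Set
  InsRobust w = Primitive w ×
    ((i : ℕ) → i Data.Nat.≤ length w → (c : V) → Primitive (insertAt i c w))

  NotInsRobustPrimitive : Word → Set
  NotInsRobustPrimitive w = Primitive w × ¬ InsRobust w

module Submission where

-- Put x = w aⁿ and suppose inserting c into x at position i gives y = vᵏ with k ≥ 2. Since
-- |y| = 2n + 1, the period |v| is at most n. If i ≤ n, then y ends with aⁿ, a full period, so y
-- and with it w lie in a*. Otherwise y = w aʳ c aˢ with r + s = n; c = a is excluded as before,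
-- and for c ≠ a the periodicity of y forces |v| > r and |v| > s, so 2|v| > n and k = 3. The
-- letter c then sits in the third copy of v = u₁ c u₂, and deleting it gives x = v v u₁ u₂.
-- Non-robustness only yields such an insertion under a double negation; the conclusion is a
-- bounded search over words of a finite alphabet, hence decidable and so stable.

open import Defs
open import Data.List using (List; []; _∷_; _++_; length; replicate; take; drop; cartesianProductWith)
open import Data.List.Properties
  using (++-assoc; ++-identityʳ; length-++; length-++-≤ˡ; length-++-≤ʳ; length-replicate; length-take; take++drop≡id; ∷-injective; ≡-dec)
open import Data.List.Membership.Propositional using (_∈_; lose)
open import Data.List.Membership.Propositional.Properties using (∈-cartesianProductWith⁺)
open import Data.List.Relation.Unary.All as All using (All)
open import Data.List.Relation.Unary.All.Properties using (++⁺; ++⁻ˡ; replicate⁺)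
open import Data.List.Relation.Unary.Any using (here; there; any?; satisfied)
open import Data.Maybe using (Maybe; just; nothing)
open import Data.Maybe.Properties using (just-injective)
open import Data.Nat using (ℕ; zero; suc; _+_; _*_; _∸_; _⊓_; _≤_; _<_; _≤?_; s≤s; s≤s⁻¹; z<s)
open import Data.Nat.Properties hiding (_≟_)
open import Data.Nat.Tactic.RingSolver using (solve)
open import Algebra.Properties.CommutativeSemigroup +-commutativeSemigroup using (x∙yz≈y∙xz)
open import Data.Product using (Σ; ∃; _×_; _,_; proj₁; proj₂)
open import Relation.Binary.Definitions using (DecidableEquality)
open import Relation.Binary.PropositionalEquality using (_≡_; _≢_; refl; sym; trans; cong; subst; subst₂; module ≡-Reasoning)
open import Relation.Nullary using (¬_; Dec; yes; no; contradiction)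
open import Relation.Nullary.Decidable using (decidable-stable; map′; _×-dec_; ¬?)
open import Relation.Unary using (Decidable)
open Alphabet using (Letter)
open Words using (_^_; InStar; insertAt; NotInsRobustPrimitive)

period-positive : ∀ k p n → (2 + k) * p ≡ suc n → 0 < p
period-positive k zero    n e = contradiction (trans (sym (*-zeroʳ (2 + k))) e) 0≢1+n
period-positive k (suc p) n e = z<s

period≤half : ∀ k p n → (2 + k) * p ≡ suc (2 * n) → p ≤ n
period≤half k p n e = s≤s⁻¹ (*-cancelˡ-< 2 p (suc n) (begin-strict
  2 * p        ≤⟨ *-monoˡ-≤ p (m≤m+n 2 k) ⟩
  (2 + k) * p  ≡⟨ e ⟩
  suc (2 * n)  <⟨ n<1+n _ ⟩
  2 + 2 * n    ≡⟨ *-suc 2 n ⟨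
  2 * suc n    ∎))
  where open ≤-Reasoning

exponent≡3 : ∀ k p {r s n} → r + s ≡ n → r < p → s < p → (2 + k) * p ≡ suc (2 * n) → k ≡ 1
exponent≡3 zero          p {r} {s} refl _   _   e = contradiction e (even≢odd p (r + s))
exponent≡3 (suc zero)    p         refl _   _   e = refl
exponent≡3 (suc (suc k)) p {r} {s} refl r<p s<p e = contradiction 2n+1<2n+1 (<-irrefl refl)
  where
    open ≤-Reasoning
    2n+1<2n+1 : suc (2 * (r + s)) < suc (2 * (r + s))
    2n+1<2n+1 = begin-strict
      suc (2 * (r + s))  <⟨ n<1+n _ ⟩
      2 + 2 * (r + s)    ≡⟨ *-suc 2 (r + s) ⟨
      2 * suc (r + s)    ≤⟨ *-monoʳ-≤ 2 (+-mono-< r<p s<p) ⟩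
      2 * (p + p)        ≡⟨ solve (p ∷ []) ⟩
      4 * p              ≤⟨ *-monoˡ-≤ p (m≤m+n 4 k) ⟩
      (4 + k) * p        ≡⟨ e ⟩
      suc (2 * (r + s))  ∎

third-copy-start : ∀ p {r s n} → r + s ≡ n → s < p → 3 * p ≡ suc (2 * n) → 2 * p ≤ n + r
third-copy-start p {r} {s} refl s<p e = +-cancelʳ-≤ (suc s) (2 * p) ((r + s) + r) (begin
  2 * p + suc s        ≤⟨ +-monoʳ-≤ (2 * p) s<p ⟩
  2 * p + p            ≡⟨ solve (p ∷ []) ⟩
  3 * p                ≡⟨ e ⟩
  suc (2 * (r + s))    ≡⟨ solve (r ∷ s ∷ []) ⟩
  (r + s) + r + suc s  ∎)
  where open ≤-Reasoning

module _ {V : Set} where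

  letterAt : List V → ℕ → Maybe V
  letterAt []       _       = nothing
  letterAt (x ∷ _)  zero    = just x
  letterAt (_ ∷ xs) (suc j) = letterAt xs j

  letterAt-++ʳ : ∀ (xs ys : List V) j → letterAt (xs ++ ys) (length xs + j) ≡ letterAt ys j
  letterAt-++ʳ []       ys j = refl
  letterAt-++ʳ (_ ∷ xs) ys j = letterAt-++ʳ xs ys j

  letterAt-++ˡ : ∀ (xs ys : List V) j {d} → letterAt xs j ≡ just d → letterAt (xs ++ ys) j ≡ just d
  letterAt-++ˡ (_ ∷ xs) ys zero    e = e
  letterAt-++ˡ (_ ∷ xs) ys (suc j) e = letterAt-++ˡ xs ys j e

  letterAt-replicate-++ : ∀ {r t} (a : V) zs → t < r → letterAt (replicate r a ++ zs) t ≡ just a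
  letterAt-replicate-++ {suc r} {zero}  a zs _         = refl
  letterAt-replicate-++ {suc r} {suc t} a zs (s≤s t<r) = letterAt-replicate-++ a zs t<r

  letterAt-replicate-++-∷ : ∀ r (a c : V) zs → letterAt (replicate r a ++ c ∷ zs) r ≡ just c
  letterAt-replicate-++-∷ zero    a c zs = refl
  letterAt-replicate-++-∷ (suc r) a c zs = letterAt-replicate-++-∷ r a c zs

  ++-injective : ∀ (xs xs' : List V) {ys ys'} → length xs ≡ length xs' →
                 xs ++ ys ≡ xs' ++ ys' → xs ≡ xs' × ys ≡ ys'
  ++-injective []       []         _ e = refl , e
  ++-injective (x ∷ xs) (x' ∷ xs') l e with ∷-injective e
  ... | refl , e' with ++-injective xs xs' (suc-injective l) e'
  ...   | refl , e'' = refl , e''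

  ++-injectiveʳ : ∀ (xs xs' : List V) {ys ys'} → length ys ≡ length ys' →
                  xs ++ ys ≡ xs' ++ ys' → ys ≡ ys'
  ++-injectiveʳ xs xs' {ys} {ys'} l e = proj₂ (++-injective xs xs' |xs|≡|xs'| e)
    where
      |xs|≡|xs'| : length xs ≡ length xs'
      |xs|≡|xs'| = +-cancelʳ-≡ (length ys) (length xs) (length xs') (begin
        length xs + length ys    ≡⟨ length-++ xs ⟨
        length (xs ++ ys)        ≡⟨ cong length e ⟩
        length (xs' ++ ys')      ≡⟨ length-++ xs' ⟩
        length xs' + length ys'  ≡⟨ cong (length xs' +_) l ⟨
        length xs' + length ys   ∎)
        where open ≡-Reasoning

  replicate-++ : ∀ m n (a : V) → replicate m a ++ replicate n a ≡ replicate (m + n) a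
  replicate-++ zero    n a = refl
  replicate-++ (suc m) n a = cong (a ∷_) (replicate-++ m n a)

  length-insertAt : ∀ i (c : V) xs → length (insertAt i c xs) ≡ suc (length xs)
  length-insertAt zero    c xs       = refl
  length-insertAt (suc i) c []       = refl
  length-insertAt (suc i) c (x ∷ xs) = cong suc (length-insertAt i c xs)

  insertAt-++ˡ : ∀ i (c : V) xs ys → i ≤ length xs → insertAt i c (xs ++ ys) ≡ insertAt i c xs ++ ys
  insertAt-++ˡ zero    c xs       ys _         = refl
  insertAt-++ˡ (suc i) c (x ∷ xs) ys (s≤s i≤n) = cong (x ∷_) (insertAt-++ˡ i c xs ys i≤n)

  insertAt-replicate : ∀ (xs : List V) r {s} (a c : V) →
    insertAt (length xs + r) c (xs ++ replicate (r + s) a) ≡ xs ++ replicate r a ++ c ∷ replicate s a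
  insertAt-replicate []       zero    a c = refl
  insertAt-replicate []       (suc r) a c = cong (a ∷_) (insertAt-replicate [] r a c)
  insertAt-replicate (x ∷ xs) r       a c = cong (x ∷_) (insertAt-replicate xs r a c)

  All-insertAt⁻ : ∀ {P : V → Set} i c xs → All P (insertAt i c xs) → All P xs
  All-insertAt⁻ zero    c xs       (_ All.∷ pxs)  = pxs
  All-insertAt⁻ (suc i) c []       _              = All.[]
  All-insertAt⁻ (suc i) c (x ∷ xs) (px All.∷ pxs) = px All.∷ All-insertAt⁻ i c xs pxs

  ^-sucʳ : ∀ (v : List V) k → v ^ suc k ≡ v ^ k ++ v
  ^-sucʳ v zero    = ++-identityʳ v
  ^-sucʳ v (suc k) = trans (cong (v ++_) (^-sucʳ v k)) (sym (++-assoc v (v ^ k) v))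

  length-^ : ∀ (v : List V) k → length (v ^ k) ≡ k * length v
  length-^ v zero    = refl
  length-^ v (suc k) = trans (length-++ v) (cong (length v +_) (length-^ v k))

  All-^ : ∀ {P : V → Set} {v} k → All P v → All P (v ^ k)
  All-^ zero    pv = All.[]
  All-^ (suc k) pv = ++⁺ pv (All-^ k pv)

  letterAt-^-periodic : ∀ (v : List V) k j {d} →
    letterAt (v ^ suc k) (length v + j) ≡ just d → letterAt (v ^ suc k) j ≡ just d
  letterAt-^-periodic v k j {d} e =
    subst (λ y → letterAt y j ≡ just d) (sym (^-sucʳ v k))
      (letterAt-++ˡ (v ^ k) v j (trans (sym (letterAt-++ʳ v (v ^ k) j)) e))

  InStar-prefix-of-power : ∀ {a : V} v k {q} u → length v ≤ q →
    v ^ suc k ≡ u ++ replicate q a → InStar a u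
  InStar-prefix-of-power {a} v k u p≤q e with m≤n⇒∃[o]m+o≡n p≤q
  ... | d , refl = ++⁻ˡ u (subst (All (_≡ a)) e (All-^ (suc k) v-in-a*))
    where
      p = length v
      split : v ^ k ++ v ≡ (u ++ replicate d a) ++ replicate p a
      split = begin
        v ^ k ++ v                          ≡⟨ ^-sucʳ v k ⟨
        v ^ suc k                           ≡⟨ e ⟩
        u ++ replicate (p + d) a            ≡⟨ cong (λ m → u ++ replicate m a) (+-comm p d) ⟩
        u ++ replicate (d + p) a            ≡⟨ cong (u ++_) (replicate-++ d p a) ⟨
        u ++ replicate d a ++ replicate p a ≡⟨ ++-assoc u _ _ ⟨
        (u ++ replicate d a) ++ replicate p a ∎
        where open ≡-Reasoning
      v-in-a* : InStar a v
      v-in-a* = subst (All (_≡ a)) (sym (++-injectiveʳ (v ^ k) _ (sym (length-replicate p)) split))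
                  (replicate⁺ p refl)

  -- A period p ≤ r would copy c one period back into aʳ; a period p ≤ s would copy an a of aˢ onto c.
  period-exceeds-left-run : ∀ (u : List V) r {a c z} v k → 0 < length v →
    u ++ replicate r a ++ c ∷ z ≡ v ^ suc k → c ≢ a → r < length v
  period-exceeds-left-run u r {a} {c} {z} v k p>0 e c≢a with length v ≤? r
  ... | no  p≰r = ≰⇒> p≰r
  ... | yes p≤r with m≤n⇒∃[o]m+o≡n p≤r
  ...   | t , refl = contradiction (just-injective (trans (sym c-at) a-at)) c≢a
    where
      p = length v
      y = u ++ replicate (p + t) a ++ c ∷ z
      atPower : ∀ j {d} → letterAt y j ≡ just d → letterAt (v ^ suc k) j ≡ just d
      atPower j {d} = subst (λ y' → letterAt y' j ≡ just d) e
      c-at : letterAt (v ^ suc k) (length u + t) ≡ just c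
      c-at = letterAt-^-periodic v k (length u + t)
        (atPower _ (subst (λ j → letterAt y j ≡ just c) (x∙yz≈y∙xz (length u) p t)
          (trans (letterAt-++ʳ u _ (p + t)) (letterAt-replicate-++-∷ (p + t) a c z))))
      a-at : letterAt (v ^ suc k) (length u + t) ≡ just a
      a-at = atPower _ (trans (letterAt-++ʳ u _ t) (letterAt-replicate-++ a _ (m<n+m t p>0)))

  period-exceeds-right-run : ∀ (u : List V) s {a c z} v k → 0 < length v →
    u ++ c ∷ replicate s a ++ z ≡ v ^ suc k → c ≢ a → s < length v
  period-exceeds-right-run u s {a} {c} {z} v k p>0 e c≢a with length v ≤? s
  ... | no  p≰s = ≰⇒> p≰s
  ... | yes p≤s with m≤n⇒∃[o]m+o≡n p>0
  ...   | t , 1+t≡p = contradiction (just-injective (trans (sym c-at) a-at)) c≢a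
    where
      p = length v
      y = u ++ c ∷ replicate s a ++ z
      atPower : ∀ j {d} → letterAt y j ≡ just d → letterAt (v ^ suc k) j ≡ just d
      atPower j {d} = subst (λ y' → letterAt y' j ≡ just d) e
      c-at : letterAt (v ^ suc k) (length u) ≡ just c
      c-at = atPower _ (subst (λ j → letterAt y j ≡ just c) (+-identityʳ (length u))
               (letterAt-++ʳ u _ 0))
      a-at : letterAt (v ^ suc k) (length u) ≡ just a
      a-at = letterAt-^-periodic v k (length u)
        (atPower _ (subst (λ j → letterAt y j ≡ just a) (trans (cong (length u +_) 1+t≡p) (+-comm (length u) p))
          (trans (letterAt-++ʳ u _ (suc t)) (letterAt-replicate-++ a z (≤-trans (≤-reflexive 1+t≡p) p≤s)))))

  insertion-into-third-copy : ∀ (u z v : List V) c → u ++ c ∷ z ≡ v ^ 3 → 2 * length v ≤ length u →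
    ∃ λ u₁ → u ++ z ≡ (u₁ ++ c ∷ z) ^ 2 ++ u₁ ++ z
  insertion-into-third-copy u z v c e 2p≤|u| = u₁ , x-decomposition
    where
      p = length v
      j = length u ∸ 2 * p
      u₁ = take j v
      2p+j≡|u| : 2 * p + j ≡ length u
      2p+j≡|u| = m+[n∸m]≡n 2p≤|u|
      |u|<3p : length u < 3 * p
      |u|<3p = begin-strict
        length u                    <⟨ m<m+n (length u) z<s ⟩
        length u + length (c ∷ z)   ≡⟨ length-++ u ⟨
        length (u ++ c ∷ z)         ≡⟨ cong length e ⟩
        length (v ^ 3)              ≡⟨ length-^ v 3 ⟩
        3 * p                       ∎
        where open ≤-Reasoning
      j<p : j < p
      j<p = +-cancelˡ-< (2 * p) j p
        (subst₂ _<_ (sym 2p+j≡|u|) (+-comm p (2 * p)) |u|<3p)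
      cube-split : v ^ 3 ≡ (v ++ v ++ u₁) ++ drop j v
      cube-split = begin
        v ++ v ++ v ++ []            ≡⟨ cong (λ t → v ++ v ++ t) (++-identityʳ v) ⟩
        v ++ v ++ v                  ≡⟨ cong (λ t → v ++ v ++ t) (take++drop≡id j v) ⟨
        v ++ v ++ u₁ ++ drop j v     ≡⟨ cong (v ++_) (++-assoc v u₁ (drop j v)) ⟨
        v ++ (v ++ u₁) ++ drop j v   ≡⟨ ++-assoc v (v ++ u₁) (drop j v) ⟨
        (v ++ v ++ u₁) ++ drop j v   ∎
        where open ≡-Reasoning
      |u|≡|vvu₁| : length u ≡ length (v ++ v ++ u₁)
      |u|≡|vvu₁| = begin
        length u                ≡⟨ 2p+j≡|u| ⟨
        2 * p + j               ≡⟨ +-assoc p (p + 0) j ⟩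
        p + ((p + 0) + j)       ≡⟨ cong (λ t → p + (t + j)) (+-identityʳ p) ⟩
        p + (p + j)             ≡⟨ cong (λ t → p + (p + t)) (m≤n⇒m⊓n≡m (<⇒≤ j<p)) ⟨
        p + (p + j ⊓ p)         ≡⟨ cong (λ t → p + (p + t)) (length-take j v) ⟨
        p + (p + length u₁)     ≡⟨ cong (p +_) (length-++ v) ⟨
        p + length (v ++ u₁)    ≡⟨ length-++ v ⟨
        length (v ++ v ++ u₁)   ∎
        where open ≡-Reasoning
      halves = ++-injective u (v ++ v ++ u₁) |u|≡|vvu₁| (trans e cube-split)
      v≡u₁cz : v ≡ u₁ ++ c ∷ z
      v≡u₁cz = trans (sym (take++drop≡id j v)) (cong (u₁ ++_) (sym (proj₂ halves)))
      x-decomposition : u ++ z ≡ (u₁ ++ c ∷ z) ^ 2 ++ u₁ ++ z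
      x-decomposition = begin
        u ++ z                          ≡⟨ cong (_++ z) (proj₁ halves) ⟩
        (v ++ v ++ u₁) ++ z             ≡⟨ ++-assoc v (v ++ u₁) z ⟩
        v ++ (v ++ u₁) ++ z             ≡⟨ cong (v ++_) (++-assoc v u₁ z) ⟩
        v ++ v ++ u₁ ++ z               ≡⟨ cong (λ t → v ++ t ++ u₁ ++ z) (++-identityʳ v) ⟨
        v ++ (v ++ []) ++ u₁ ++ z       ≡⟨ ++-assoc v (v ++ []) (u₁ ++ z) ⟨
        v ^ 2 ++ u₁ ++ z                ≡⟨ cong (λ t → t ^ 2 ++ u₁ ++ z) v≡u₁cz ⟩
        (u₁ ++ c ∷ z) ^ 2 ++ u₁ ++ z    ∎
        where open ≡-Reasoning

  module _ (letters : List V) (complete : ∀ c → c ∈ letters) where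

    wordsUpTo : ℕ → List (List V)
    wordsUpTo zero    = [] ∷ []
    wordsUpTo (suc L) = [] ∷ cartesianProductWith _∷_ letters (wordsUpTo L)

    ∈-wordsUpTo : ∀ L (u : List V) → length u ≤ L → u ∈ wordsUpTo L
    ∈-wordsUpTo zero    []      _         = here refl
    ∈-wordsUpTo (suc L) []      _         = here refl
    ∈-wordsUpTo (suc L) (c ∷ u) (s≤s |u|≤L) =
      there (∈-cartesianProductWith⁺ _∷_ (complete c) (∈-wordsUpTo L u |u|≤L))

    shortWord? : ∀ {P : List V → Set} L → Decidable P → (∀ {u} → P u → length u ≤ L) → Dec (∃ P)
    shortWord? L P? short = map′ satisfied (λ (u , pu) → lose (∈-wordsUpTo L u (short pu)) pu) (any? P? (wordsUpTo L))

    letter? : ∀ {P : V → Set} → Decidable P → Dec (∃ P)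
    letter? P? = map′ satisfied (λ (c , pc) → lose (complete c) pc) (any? P? letters)

  CubeMinusLetter : V → List V → Set
  CubeMinusLetter a x = Σ (List V) λ u₁ → Σ (List V) λ u₂ → Σ V λ b →
    (b ≢ a) × (x ≡ ((u₁ ++ b ∷ u₂) ^ 2) ++ u₁ ++ u₂)

  length-w-aⁿ : ∀ (w : List V) a → length (w ++ replicate (length w) a) ≡ 2 * length w
  length-w-aⁿ w a = begin
    length (w ++ replicate n a)       ≡⟨ length-++ w ⟩
    n + length (replicate n a)        ≡⟨ cong (n +_) (length-replicate n) ⟩
    n + n                             ≡⟨ cong (n +_) (+-identityʳ n) ⟨
    2 * n                             ∎
    where
      open ≡-Reasoning
      n = length w

  period-of-insertion : ∀ (w : List V) {a c} v i k →
    insertAt i c (w ++ replicate (length w) a) ≡ v ^ (2 + k) → (2 + k) * length v ≡ suc (2 * length w)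
  period-of-insertion w {a} {c} v i k e = begin
    (2 + k) * length v                          ≡⟨ length-^ v (2 + k) ⟨
    length (v ^ (2 + k))                        ≡⟨ cong length e ⟨
    length (insertAt i c (w ++ replicate _ a))  ≡⟨ length-insertAt i c _ ⟩
    suc (length (w ++ replicate _ a))           ≡⟨ cong suc (length-w-aⁿ w a) ⟩
    suc (2 * length w)                          ∎
    where open ≡-Reasoning

  insertion-into-w : ∀ (w : List V) {a c} v i k → i ≤ length w →
    insertAt i c (w ++ replicate (length w) a) ≡ v ^ (2 + k) → InStar a w
  insertion-into-w w {a} {c} v i k i≤n e =
    All-insertAt⁻ i c w (InStar-prefix-of-power v (suc k) (insertAt i c w) p≤n (trans (sym e) (insertAt-++ˡ i c w _ i≤n)))
    where
      p≤n : length v ≤ length w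
      p≤n = period≤half k (length v) (length w) (period-of-insertion w v i k e)

  module _ (_≟_ : DecidableEquality V) where

    insertion-into-aⁿ : ∀ (w : List V) {a c} v k r s → length w ≡ r + s → ¬ InStar a w →
      (2 + k) * length v ≡ suc (2 * length w) →
      w ++ replicate r a ++ c ∷ replicate s a ≡ v ^ (2 + k) →
      CubeMinusLetter a (w ++ replicate (length w) a)
    insertion-into-aⁿ w {a} {c} v k r s n≡r+s w∉a* len e with c ≟ a
    ... | yes refl = contradiction (InStar-prefix-of-power v (suc k) w p≤r+1+s (sym y-in-a*)) w∉a*
      where
        y-in-a* : w ++ replicate (r + suc s) a ≡ v ^ (2 + k)
        y-in-a* = trans (cong (w ++_) (sym (replicate-++ r (suc s) a))) e
        p≤r+1+s : length v ≤ r + suc s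
        p≤r+1+s = ≤-trans (period≤half k _ _ len) (≤-trans (≤-reflexive n≡r+s) (+-monoʳ-≤ r (n≤1+n s)))
    ... | no c≢a = u₁ , replicate s a , c , c≢a , trans x≡u++z x≡cube
      where
        p = length v
        u = w ++ replicate r a
        p>0 = period-positive k p _ len
        e′ : u ++ c ∷ replicate s a ≡ v ^ (2 + k)
        e′ = trans (++-assoc w (replicate r a) _) e
        r<p : r < p
        r<p = period-exceeds-left-run w r v (suc k) p>0 e c≢a
        s<p : s < p
        s<p = period-exceeds-right-run u s v (suc k) p>0
                (trans (cong (λ z → u ++ c ∷ z) (++-identityʳ (replicate s a))) e′) c≢a
        k≡1 : k ≡ 1
        k≡1 = exponent≡3 k p (sym n≡r+s) r<p s<p len
        2p≤|u| : 2 * p ≤ length u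
        2p≤|u| = ≤-trans (third-copy-start p (sym n≡r+s) s<p (subst (λ m → (2 + m) * p ≡ _) k≡1 len))
                   (≤-reflexive (trans (cong (length w +_) (sym (length-replicate r))) (sym (length-++ w))))
        third-copy = insertion-into-third-copy u (replicate s a) v c (subst (λ m → _ ≡ v ^ (2 + m)) k≡1 e′) 2p≤|u|
        u₁ = proj₁ third-copy
        x≡cube = proj₂ third-copy
        x≡u++z : w ++ replicate (length w) a ≡ u ++ replicate s a
        x≡u++z = begin
          w ++ replicate (length w) a            ≡⟨ cong (λ m → w ++ replicate m a) n≡r+s ⟩
          w ++ replicate (r + s) a               ≡⟨ cong (w ++_) (replicate-++ r s a) ⟨
          w ++ replicate r a ++ replicate s a    ≡⟨ ++-assoc w _ _ ⟨
          u ++ replicate s a                     ∎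
          where open ≡-Reasoning

    insertion-into-w-aⁿ : ∀ (w : List V) {a c} v i k → ¬ InStar a w →
      i ≤ length (w ++ replicate (length w) a) →
      insertAt i c (w ++ replicate (length w) a) ≡ v ^ (2 + k) →
      CubeMinusLetter a (w ++ replicate (length w) a)
    insertion-into-w-aⁿ w {a} {c} v i k w∉a* i≤|x| e with i ≤? length w
    ... | yes i≤n = contradiction (insertion-into-w w v i k i≤n e) w∉a*
    ... | no  i≰n with m≤n⇒∃[o]m+o≡n (≰⇒≥ i≰n)
    ...   | r , refl with m≤n⇒∃[o]m+o≡n r≤n
      where
        r≤n : r ≤ length w
        r≤n = +-cancelˡ-≤ (length w) r (length w)
                (≤-trans i≤|x| (≤-reflexive (trans (length-w-aⁿ w a) (cong (length w +_) (+-identityʳ (length w))))))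
    ...     | s , r+s≡n = insertion-into-aⁿ w v k r s (sym r+s≡n) w∉a* (period-of-insertion w v _ k e) y≡power
      where
        y≡power : w ++ replicate r a ++ c ∷ replicate s a ≡ v ^ (2 + k)
        y≡power = begin
          w ++ replicate r a ++ c ∷ replicate s a                ≡⟨ insertAt-replicate w r a c ⟨
          insertAt (length w + r) c (w ++ replicate (r + s) a)   ≡⟨ cong (λ m → insertAt (length w + r) c (w ++ replicate m a)) r+s≡n ⟩
          insertAt (length w + r) c (w ++ replicate (length w) a) ≡⟨ e ⟩
          v ^ (2 + k)                                            ∎
          where open ≡-Reasoning

    cubeMinusLetter? : (letters : List V) → (∀ c → c ∈ letters) → ∀ a x → Dec (CubeMinusLetter a x)
    cubeMinusLetter? letters complete a x =
      shortWord? letters complete (length x) (λ u₁ →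
        shortWord? letters complete (length x) (λ u₂ →
          letter? letters complete λ b → ¬? (b ≟ a) ×-dec ≡-dec _≟_ x (((u₁ ++ b ∷ u₂) ^ 2) ++ u₁ ++ u₂))
        λ {u₂} (b , _ , e) → ≤-trans (≤-trans (length-++-≤ʳ u₂ {u₁}) (length-++-≤ʳ (u₁ ++ u₂) {(u₁ ++ b ∷ u₂) ^ 2}))
                                 (≤-reflexive (sym (cong length e))))
      λ {u₁} (u₂ , b , _ , e) → ≤-trans (≤-trans (length-++-≤ˡ u₁) (length-++-≤ʳ (u₁ ++ u₂) {(u₁ ++ b ∷ u₂) ^ 2}))
                                  (≤-reflexive (sym (cong length e)))

theorem15 : (A : Alphabet) (w : List (Letter A)) (a : Letter A) →
    ¬ InStar a w →
    NotInsRobustPrimitive (w ++ replicate (length w) a) →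
    Σ (List (Letter A)) λ u₁ → Σ (List (Letter A)) λ u₂ → Σ (Letter A) λ b →
    (b ≢ a) × (w ++ replicate (length w) a ≡ ((u₁ ++ b ∷ u₂) ^ 2) ++ u₁ ++ u₂)
theorem15 A w a w∉a* (x-primitive , ¬robust) =
  decidable-stable (cubeMinusLetter? _≟_ letters complete a x) λ ¬cube →
    ¬robust (x-primitive , λ i i≤|x| c → insertion-nonempty i c ,
      λ { (v , suc (suc k) , _ , e) → ¬cube (insertion-into-w-aⁿ _≟_ w v i k w∉a* i≤|x| e)
        ; (_ , 0 , () , _)
        ; (_ , 1 , s≤s () , _) })
  where
    open Alphabet A using (_≟_; letters; complete)
    x = w ++ replicate (length w) a
    insertion-nonempty : ∀ i c → insertAt i c x ≢ []
    insertion-nonempty i c e = 0≢1+n (trans (sym (cong length e)) (length-insertAt i c x))
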